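{- Let $v, w \in S_n$ be fully commutative permutations with $w = v s_i$ and $\ell(w) = \ell(v)+1$, and suppose $i \in \operatorname{supp}(v)$. Let $M := \max\{v(j) : j \le i\}$ and $m := \min\{v(j) : j \ge i+1\}$, and let $p \le i$ and $q \ge i+1$ be the positions with $v(p) = M$ and $v(q) = m$. Writing $a_1, \ldots, a_h$ for $v(p+1), \ldots, v(i-1)$ and $e_1, \ldots, e_j$ for $v(i+2), \ldots, v(q-1)$, so that $$v = \cdots M\, a_1 \cdots a_h\, v(i)\, v(i+1)\, e_1 \cdots e_j\, m \cdots,$$ we have $$a_1 < a_2 < \cdots < a_h < v(i) < m < M < v(i+1) < e_1 < e_2 < \cdots < e_j.$$
   Context: A permutation is fully commutative iff it avoids $321$. $s_i$ swaps $i,i+1$ (so $vs_i$ swaps the entries of $v$ in positions $i$ and $i+1$), and $\ell$ is Coxeter length. $\operatorname{supp}(v)$ is the set of letters appearing in reduced words of $v$; equivalently $i\in\operatorname{supp}(v)$ iff $\{v(1),\dots,v(i)\}\ne\{1,\dots,i\}$. -}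

module Defs where

open import Data.Nat using (ℕ; suc; _≤_; _<_; _<?_)
open import Data.Fin using (Fin; toℕ; inject₁) renaming (suc to fsuc)
open import Data.Fin.Permutation using (Permutation′; _⟨$⟩ʳ_; _∘ₚ_; transpose)
open import Data.List using (List; length; filter; cartesianProduct; allFin)
open import Data.Product using (Σ; ∃; _×_; _,_; proj₁; proj₂)
open import Relation.Nullary using (¬_)
open import Relation.Nullary.Decidable using (_×-dec_)
open import Relation.Binary.PropositionalEquality using (_≡_)

-- S_n : permutations of Fin n (positions and values are 0-indexed;
-- paper position / value j corresponds to the Fin element with toℕ = j - 1).
Perm : ℕ → Set
Perm n = Permutation′ n

val : ∀ {n} → Perm n → Fin n → ℕ
val v j = toℕ (v ⟨$⟩ʳ j)

-- fully commutative = 321-avoiding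
FullyCommutative : ∀ {n} → Perm n → Set
FullyCommutative {n} v =
  ¬ (Σ (Fin n) λ a → Σ (Fin n) λ b → Σ (Fin n) λ c →
       toℕ a < toℕ b × toℕ b < toℕ c × val v c < val v b × val v b < val v a)

-- Coxeter length = number of inversions
len : ∀ {n} → Perm n → ℕ
len {n} v = length (filter (λ ab → (toℕ (proj₁ ab) <? toℕ (proj₂ ab))
                                   ×-dec (val v (proj₂ ab) <? val v (proj₁ ab)))
                           (cartesianProduct (allFin n) (allFin n)))

-- simple transposition s_i for t : Fin k acting on Fin (suc k), paper i = toℕ t + 1:
-- it swaps the (0-indexed) positions inject₁ t and suc t.
-- v · s_i : the permutation j ↦ v(s_i(j)), i.e. v with entries in positions i, i+1 swapped.
_·s_ : ∀ {k} → Perm (suc k) → Fin k → Perm (suc k)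
v ·s t = transpose (inject₁ t) (fsuc t) ∘ₚ v

-- i ∈ supp(v)  iff  {v(1),…,v(i)} ≠ {1,…,i}   (paper i = toℕ t + 1; 0-indexed
-- this is: the set {v(j) : toℕ j ≤ toℕ t} differs from {x : toℕ x ≤ toℕ t})
InSupp : ∀ {k} → Perm (suc k) → Fin k → Set
InSupp {k} v t =
  ¬ ( (∀ (j : Fin (suc k)) → toℕ j ≤ toℕ t → val v j ≤ toℕ t)
    × (∀ (x : Fin (suc k)) → toℕ x ≤ toℕ t →
         ∃ λ (j : Fin (suc k)) → toℕ j ≤ toℕ t × v ⟨$⟩ʳ j ≡ x) )

module Submission where

-- Since ℓ(v s_i) = ℓ(v) + 1 we have x := v(i) < v(i+1) =: y, so v s_i contains the
-- descent y x at positions i, i+1.  As v s_i avoids 321, no entry after this descent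
-- is below x and no entry before it is above y; this gives x < m and M < y.  If M < m,
-- the first i entries of v would all lie below the remaining ones, so by counting they
-- would be {1, …, i}, contradicting i ∈ supp(v); hence m < M.  Finally a descent among
-- the a's (resp. the e's) would form a 321 pattern together with M (resp. m).

open import Defs
open import Data.Bool using (true; false)
open import Data.Fin using (Fin; toℕ; inject₁; inject≤; fromℕ<) renaming (zero to fzero; suc to fsuc)
open import Data.Fin.Permutation using (_⟨$⟩ʳ_; _⟨$⟩ˡ_; inverseʳ; transpose; flip)
import Data.Fin.Permutation.Components as PC
open import Data.Fin.Properties
  using (toℕ-injective; toℕ<n; toℕ-inject₁; toℕ-inject≤; inject≤-injective; fromℕ<-injective;
         injective⇒≤; _≟_; ≤̄⇒inject₁<)
  renaming (<⇒≢ to <⇒≢ᶠ)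
open import Data.List using (List; _++_; length; filter; cartesianProduct; tabulate; map)
open import Data.List.Properties using (length-++; filter-++; map-tabulate)
open import Data.Nat using (ℕ; zero; suc; _+_; _≤_; _<_; z≤n; s≤s; s≤s⁻¹; _≤?_; _<?_)
open import Data.Nat.Properties
  using (+-0-commutativeMonoid; +-mono-≤; ≤-refl; ≤-reflexive; <⇒≤; ≮⇒≥; ≰⇒>; ≤⇒≯;
         ≤∧≢⇒<; <-asym; <-trans; ≤-<-trans; <-≤-trans; n≤1+n; 1+n≰n; module ≤-Reasoning)
open import Algebra.Properties.CommutativeMonoid.Sum +-0-commutativeMonoid
  using (sum; sum-cong-≗; sum-permute)
open import Data.Product using (∃; _×_; _,_; proj₁; proj₂)
open import Function using (id; _∘_)
open import Function.Bundles using (Injection)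
open import Function.Definitions using (Injective)
open import Function.Properties.Inverse using (↔⇒↣)
open import Level using (0ℓ)
open import Relation.Binary.PropositionalEquality
open import Relation.Nullary using (¬_; Dec; yes; no; _because_; contradiction)
open import Relation.Nullary.Decidable using (_×-dec_; dec-true; dec-false)
open import Relation.Nullary.Reflects using (invert)
open import Relation.Unary using (Pred; Decidable)

indicator : ∀ {A : Set} → Dec A → ℕ
indicator (true  because _) = 1
indicator (false because _) = 0

indicator-mono : ∀ {A B : Set} (a? : Dec A) (b? : Dec B) → (A → B) → indicator a? ≤ indicator b?
indicator-mono (false because _)   _                     _   = z≤n
indicator-mono (true  because _)   (true  because _)     _   = ≤-refl
indicator-mono (true  because [a]) (false because [¬b]) a→b = contradiction (a→b (invert [a])) (invert [¬b])

sum-mono-≤ : ∀ {n} {f g : Fin n → ℕ} → (∀ i → f i ≤ g i) → sum f ≤ sum g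
sum-mono-≤ {zero}  f≤g = z≤n
sum-mono-≤ {suc n} f≤g = +-mono-≤ (f≤g fzero) (sum-mono-≤ (f≤g ∘ fsuc))

module _ {A : Set} {P : Pred A 0ℓ} (P? : Decidable P) where

  length-filter-++ : ∀ (xs ys : List A) →
    length (filter P? (xs ++ ys)) ≡ length (filter P? xs) + length (filter P? ys)
  length-filter-++ xs ys = trans (cong length (filter-++ P? xs ys)) (length-++ (filter P? xs))

  length-filter-tabulate : ∀ {n} (f : Fin n → A) →
    length (filter P? (tabulate f)) ≡ sum (λ i → indicator (P? (f i)))
  length-filter-tabulate {zero}  f = refl
  length-filter-tabulate {suc n} f with P? (f fzero)
  ... | true  because _ = cong suc (length-filter-tabulate (f ∘ fsuc))
  ... | false because _ = length-filter-tabulate (f ∘ fsuc)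

module _ {B C : Set} {P : Pred (B × C) 0ℓ} (P? : Decidable P) where

  length-filter-cartesianProduct : ∀ {m n} (f : Fin m → B) (g : Fin n → C) →
    length (filter P? (cartesianProduct (tabulate f) (tabulate g))) ≡
    sum (λ i → sum (λ j → indicator (P? (f i , g j))))
  length-filter-cartesianProduct {zero}  f g = refl
  length-filter-cartesianProduct {suc m} f g =
    trans (length-filter-++ P? (map (f fzero ,_) (tabulate g)) _)
          (cong₂ _+_ first-row (length-filter-cartesianProduct (f ∘ fsuc) g))
    where
    first-row : length (filter P? (map (f fzero ,_) (tabulate g))) ≡
                sum (λ j → indicator (P? (f fzero , g j)))
    first-row = trans (cong (length ∘ filter P?) (map-tabulate g (f fzero ,_)))
                      (length-filter-tabulate P? (λ j → f fzero , g j))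

Inversion : ∀ {n} → Perm n → Fin n → Fin n → Set
Inversion u a b = toℕ a < toℕ b × val u b < val u a

inversion? : ∀ {n} (u : Perm n) (ab : Fin n × Fin n) → Dec (Inversion u (proj₁ ab) (proj₂ ab))
inversion? u ab = (toℕ (proj₁ ab) <? toℕ (proj₂ ab)) ×-dec (val u (proj₂ ab) <? val u (proj₁ ab))

len≡sum-inversions : ∀ {n} (u : Perm n) →
  len u ≡ sum (λ a → sum (λ b → indicator (inversion? u (a , b))))
len≡sum-inversions u = length-filter-cartesianProduct (inversion? u) id id

inversion-preserving⇒len-≤ : ∀ {n} {u u′ : Perm n} (π : Perm n) →
  (∀ a b → Inversion u a b → Inversion u′ (π ⟨$⟩ʳ a) (π ⟨$⟩ʳ b)) → len u ≤ len u′
inversion-preserving⇒len-≤ {u = u} {u′} π preserves = begin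
  len u                                             ≡⟨ len≡sum-inversions u ⟩
  sum (λ a → sum (λ b → I u (a , b)))               ≤⟨ sum-mono-≤ (λ a → sum-mono-≤ (λ b →
                                                        indicator-mono _ _ (preserves a b))) ⟩
  sum (λ a → sum (λ b → I u′ (π ⟨$⟩ʳ a , π ⟨$⟩ʳ b))) ≡⟨ sum-permute (λ a → sum (λ b → I u′ (a , π ⟨$⟩ʳ b))) π ⟨
  sum (λ a → sum (λ b → I u′ (a , π ⟨$⟩ʳ b)))        ≡⟨ sum-cong-≗ (λ a → sum-permute (λ b → I u′ (a , b)) π) ⟨
  sum (λ a → sum (λ b → I u′ (a , b)))              ≡⟨ len≡sum-inversions u′ ⟨
  len u′                                            ∎
  where
  open ≤-Reasoning
  I : (w : Perm _) → Fin _ × Fin _ → ℕ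
  I w = indicator ∘ inversion? w

val-injective : ∀ {n} (u : Perm n) {a b} → val u a ≡ val u b → a ≡ b
val-injective u = Injection.injective (↔⇒↣ u) ∘ toℕ-injective

val-≤∧≢⇒< : ∀ {n} (u : Perm n) {a b} → val u a ≤ val u b → a ≢ b → val u a < val u b
val-≤∧≢⇒< u va≤vb a≢b = ≤∧≢⇒< va≤vb (a≢b ∘ val-injective u)

injective-maps-below⇒≤ : ∀ {N a b} {g : Fin N → Fin N} → Injective _≡_ _≡_ g → a ≤ N →
  (∀ i → toℕ i < a → toℕ (g i) < b) → a ≤ b
injective-maps-below⇒≤ {a = a} {b} {g} g-injective a≤N g-below = injective⇒≤ {f = h} h-injective
  where
  h : Fin a → Fin b
  h i = fromℕ< (g-below (inject≤ i a≤N) (subst (_< a) (sym (toℕ-inject≤ i a≤N)) (toℕ<n i)))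
  h-injective : Injective _≡_ _≡_ h
  h-injective {x} {y} hx≡hy =
    inject≤-injective a≤N a≤N x y (g-injective (toℕ-injective (fromℕ<-injective _ _ _ _ hx≡hy)))

module _ {n} (u : Perm n) (fc : FullyCommutative u) {a b c : Fin n}
         (a<b : toℕ a < toℕ b) (b<c : toℕ b < toℕ c) where

  ascent-after-inversion : val u b < val u a → val u b < val u c
  ascent-after-inversion vb<va =
    val-≤∧≢⇒< u (≮⇒≥ λ vc<vb → fc (a , b , c , a<b , b<c , vc<vb , vb<va)) (<⇒≢ᶠ b<c)

  ascent-before-inversion : val u c < val u b → val u a < val u b
  ascent-before-inversion vc<vb =
    val-≤∧≢⇒< u (≮⇒≥ λ vb<va → fc (a , b , c , a<b , b<c , vc<vb , vb<va)) (<⇒≢ᶠ a<b)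

transpose-matchˡ : ∀ {n} (i j : Fin n) → PC.transpose i j i ≡ j
transpose-matchˡ i j rewrite dec-true (i ≟ i) refl = refl

transpose-matchʳ : ∀ {n} (i j : Fin n) → PC.transpose i j j ≡ i
transpose-matchʳ i j with j ≟ i
... | yes j≡i = j≡i
... | no  j≢i rewrite dec-true (j ≟ j) refl = refl

transpose-mismatch : ∀ {n} {i j k : Fin n} → k ≢ i → k ≢ j → PC.transpose i j k ≡ k
transpose-mismatch {i = i} {j} {k} k≢i k≢j rewrite dec-false (k ≟ i) k≢i | dec-false (k ≟ j) k≢j = refl

adjacentSwap : ∀ {k} → Fin k → Fin (suc k) → Fin (suc k)
adjacentSwap t = PC.transpose (inject₁ t) (fsuc t)

module _ {k} (t : Fin k) where

  inject₁<suc : toℕ (inject₁ t) < toℕ (fsuc t)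
  inject₁<suc = ≤̄⇒inject₁< ≤-refl

  >t⇒≢inject₁ : ∀ {c} → toℕ t < toℕ c → c ≢ inject₁ t
  >t⇒≢inject₁ t<c = <⇒≢ᶠ (subst (_< _) (sym (toℕ-inject₁ t)) t<c) ∘ sym

  ≤t⇒≢suc : ∀ {c} → toℕ c ≤ toℕ t → c ≢ fsuc t
  ≤t⇒≢suc c≤t = <⇒≢ᶠ (s≤s c≤t)

  ≢inject₁⇒toℕ≢ : ∀ {c} → c ≢ inject₁ t → toℕ c ≢ toℕ t
  ≢inject₁⇒toℕ≢ c≢i c≡t = c≢i (toℕ-injective (trans c≡t (sym (toℕ-inject₁ t))))

  adjacentSwap-≤ : ∀ {c} → c ≢ inject₁ t → toℕ (adjacentSwap t c) ≤ toℕ c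
  adjacentSwap-≤ {c} c≢i with c ≟ fsuc t
  ... | yes refl rewrite transpose-matchʳ (inject₁ t) (fsuc t) | toℕ-inject₁ t = n≤1+n (toℕ t)
  ... | no  c≢s  rewrite transpose-mismatch c≢i c≢s = ≤-refl

  adjacentSwap-≥ : ∀ {c} → c ≢ fsuc t → toℕ c ≤ toℕ (adjacentSwap t c)
  adjacentSwap-≥ {c} c≢s with c ≟ inject₁ t
  ... | yes refl = <⇒≤ inject₁<suc
  ... | no  _    rewrite dec-false (c ≟ fsuc t) c≢s = ≤-refl

  adjacentSwap-< : ∀ {a b} → toℕ a < toℕ b → ¬ (a ≡ inject₁ t × b ≡ fsuc t) →
                   toℕ (adjacentSwap t a) < toℕ (adjacentSwap t b)
  adjacentSwap-< {a} {b} = by-cases (a ≟ inject₁ t) (b ≟ fsuc t)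
    where
    open ≤-Reasoning
    by-cases : ∀ {a b} → Dec (a ≡ inject₁ t) → Dec (b ≡ fsuc t) →
               toℕ a < toℕ b → ¬ (a ≡ inject₁ t × b ≡ fsuc t) →
               toℕ (adjacentSwap t a) < toℕ (adjacentSwap t b)
    by-cases (yes a≡i) (yes b≡s) _ not-i,i+1 = contradiction (a≡i , b≡s) not-i,i+1
    by-cases {b = b} (yes refl) (no b≢s) i<b _ = begin-strict
      toℕ (adjacentSwap t (inject₁ t)) ≡⟨ cong toℕ (transpose-matchˡ (inject₁ t) (fsuc t)) ⟩
      suc (toℕ t)                      <⟨ ≤∧≢⇒< (subst (_< toℕ b) (toℕ-inject₁ t) i<b)
                                                 (b≢s ∘ toℕ-injective ∘ sym) ⟩
      toℕ b                            ≤⟨ adjacentSwap-≥ b≢s ⟩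
      toℕ (adjacentSwap t b)           ∎
    by-cases {a = a} (no a≢i) (yes refl) a<s _ = begin-strict
      toℕ (adjacentSwap t a)           ≤⟨ adjacentSwap-≤ a≢i ⟩
      toℕ a                            <⟨ ≤∧≢⇒< (s≤s⁻¹ a<s) (≢inject₁⇒toℕ≢ a≢i) ⟩
      toℕ t                            ≡⟨ toℕ-inject₁ t ⟨
      toℕ (inject₁ t)                  ≡⟨ cong toℕ (transpose-matchʳ (inject₁ t) (fsuc t)) ⟨
      toℕ (adjacentSwap t (fsuc t))    ∎
    by-cases (no a≢i) (no b≢s) a<b _ = <-≤-trans (≤-<-trans (adjacentSwap-≤ a≢i) a<b) (adjacentSwap-≥ b≢s)

module _ {k} (v : Perm (suc k)) (t : Fin k) where

  val-·s-inject₁ : val (v ·s t) (inject₁ t) ≡ val v (fsuc t)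
  val-·s-inject₁ = cong (val v) (transpose-matchˡ (inject₁ t) (fsuc t))

  val-·s-suc : val (v ·s t) (fsuc t) ≡ val v (inject₁ t)
  val-·s-suc = cong (val v) (transpose-matchʳ (inject₁ t) (fsuc t))

  val-·s-other : ∀ {c} → c ≢ inject₁ t → c ≢ fsuc t → val (v ·s t) c ≡ val v c
  val-·s-other c≢i c≢s = cong (val v) (transpose-mismatch c≢i c≢s)

  descent⇒len-·s-≤ : val v (fsuc t) < val v (inject₁ t) → len (v ·s t) ≤ len v
  descent⇒len-·s-≤ descent = inversion-preserving⇒len-≤ {u = v ·s t} {v} (transpose (inject₁ t) (fsuc t))
    (λ a b inv@(a<b , _) → adjacentSwap-< t a<b (not-adjacent inv) , proj₂ inv)
    where
    not-adjacent : ∀ {a b} → Inversion (v ·s t) a b → ¬ (a ≡ inject₁ t × b ≡ fsuc t)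
    not-adjacent (_ , inv) (refl , refl) = <-asym descent (subst₂ _<_ val-·s-suc val-·s-inject₁ inv)

  len-·s≡suc⇒ascent : len (v ·s t) ≡ suc (len v) → val v (inject₁ t) < val v (fsuc t)
  len-·s≡suc⇒ascent len≡ = val-≤∧≢⇒< v
    (≮⇒≥ λ descent → 1+n≰n (subst (_≤ len v) len≡ (descent⇒len-·s-≤ descent)))
    (<⇒≢ᶠ (inject₁<suc t))

  module _ (fc : FullyCommutative (v ·s t)) (ascent : val v (inject₁ t) < val v (fsuc t)) where

    private
      descent : val (v ·s t) (fsuc t) < val (v ·s t) (inject₁ t)
      descent = subst₂ _<_ (sym val-·s-suc) (sym val-·s-inject₁) ascent

    ascent-bottom<suffix : ∀ {q} → toℕ t < toℕ q → val v (inject₁ t) < val v q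
    ascent-bottom<suffix {q} t<q with q ≟ fsuc t
    ... | yes refl = ascent
    ... | no  q≢s  = subst₂ _<_ val-·s-suc (val-·s-other (>t⇒≢inject₁ t t<q) q≢s)
                       (ascent-after-inversion (v ·s t) fc (inject₁<suc t) s<q descent)
      where
      s<q : suc (toℕ t) < toℕ q
      s<q = ≤∧≢⇒< t<q (q≢s ∘ toℕ-injective ∘ sym)

    prefix<ascent-top : ∀ {p} → toℕ p ≤ toℕ t → val v p < val v (fsuc t)
    prefix<ascent-top {p} p≤t with p ≟ inject₁ t
    ... | yes refl = ascent
    ... | no  p≢i  = subst₂ _<_ (val-·s-other p≢i (≤t⇒≢suc t p≤t)) val-·s-inject₁
                       (ascent-before-inversion (v ·s t) fc p<i (inject₁<suc t) descent)
      where
      p<i : toℕ p < toℕ (inject₁ t)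
      p<i = subst (toℕ p <_) (sym (toℕ-inject₁ t))
                  (≤∧≢⇒< p≤t (≢inject₁⇒toℕ≢ t p≢i))

  separated⇒¬InSupp : (∀ j j′ → toℕ j ≤ toℕ t → toℕ t < toℕ j′ → val v j < val v j′) → ¬ InSupp v t
  separated⇒¬InSupp separated in-supp = in-supp (prefix-values , prefix-covered)
    where
    v-injective : Injective _≡_ _≡_ (v ⟨$⟩ʳ_)
    v-injective = Injection.injective (↔⇒↣ v)

    v⁻¹-injective : Injective _≡_ _≡_ (v ⟨$⟩ˡ_)
    v⁻¹-injective = Injection.injective (↔⇒↣ (flip v))

    val-v⁻¹ : ∀ x → val v (v ⟨$⟩ˡ x) ≡ toℕ x
    val-v⁻¹ x = cong toℕ (inverseʳ v)

    -- the values 0, …, v(j) all sit in the prefix, so there are at most t + 1 of them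
    prefix-values : ∀ j → toℕ j ≤ toℕ t → val v j ≤ toℕ t
    prefix-values j j≤t with val v j ≤? toℕ t
    ... | yes vj≤t = vj≤t
    ... | no  vj≰t = contradiction (injective-maps-below⇒≤ v⁻¹-injective (toℕ<n (v ⟨$⟩ʳ j)) in-prefix)
                                   (vj≰t ∘ s≤s⁻¹)
      where
      in-prefix : ∀ x → toℕ x < suc (val v j) → toℕ (v ⟨$⟩ˡ x) < suc (toℕ t)
      in-prefix x x≤vj with toℕ (v ⟨$⟩ˡ x) ≤? toℕ t
      ... | yes pos≤t = s≤s pos≤t
      ... | no  pos≰t = contradiction (subst (val v j <_) (val-v⁻¹ x) (separated j _ j≤t (≰⇒> pos≰t)))
                                      (≤⇒≯ (s≤s⁻¹ x≤vj))

    -- if x sat after the prefix, the t + 1 prefix values would all lie below x ≤ t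
    prefix-covered : ∀ x → toℕ x ≤ toℕ t → ∃ λ j → toℕ j ≤ toℕ t × v ⟨$⟩ʳ j ≡ x
    prefix-covered x x≤t with toℕ (v ⟨$⟩ˡ x) ≤? toℕ t
    ... | yes pos≤t = v ⟨$⟩ˡ x , pos≤t , inverseʳ v
    ... | no  pos≰t = contradiction (injective-maps-below⇒≤ v-injective (<⇒≤ (toℕ<n (fsuc t))) below-x)
                                    (≤⇒≯ x≤t)
      where
      below-x : ∀ i → toℕ i < suc (toℕ t) → toℕ (v ⟨$⟩ʳ i) < toℕ x
      below-x i i≤t = subst (val v i <_) (val-v⁻¹ x) (separated i _ (s≤s⁻¹ i≤t) (≰⇒> pos≰t))

corollary4p2 : ∀ (k : ℕ) (v : Perm (suc k)) (t : Fin k) →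
    FullyCommutative v → FullyCommutative (v ·s t) →
    len (v ·s t) ≡ suc (len v) → InSupp v t →
    ∀ (p q : Fin (suc k)) →
    toℕ p ≤ toℕ t → (∀ (j : Fin (suc k)) → toℕ j ≤ toℕ t → val v j ≤ val v p) →
    toℕ t < toℕ q → (∀ (j : Fin (suc k)) → toℕ t < toℕ j → val v q ≤ val v j) →
    (∀ (j j′ : Fin (suc k)) → toℕ p < toℕ j → toℕ j′ ≡ suc (toℕ j) → toℕ j′ ≤ toℕ t →
       val v j < val v j′)
    × val v (inject₁ t) < val v q
    × val v q < val v p
    × val v p < val v (fsuc t)
    × (∀ (j j′ : Fin (suc k)) → toℕ t < toℕ j → toℕ j′ ≡ suc (toℕ j) → toℕ j′ < toℕ q →
       val v j < val v j′)
corollary4p2 k v t fc-v fc-w len-w in-supp p q p≤t p-max t<q q-min =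
  a-increasing , ascent-bottom<suffix v t fc-w ascent t<q , m<M ,
  prefix<ascent-top v t fc-w ascent p≤t , e-increasing
  where
  ascent : val v (inject₁ t) < val v (fsuc t)
  ascent = len-·s≡suc⇒ascent v t len-w

  m<M : val v q < val v p
  m<M = val-≤∧≢⇒< v (≮⇒≥ λ M<m → separated⇒¬InSupp v t
          (λ j j′ j≤t t<j′ → ≤-<-trans (p-max j j≤t) (<-≤-trans M<m (q-min j′ t<j′))) in-supp)
          (<⇒≢ᶠ (≤-<-trans p≤t t<q) ∘ sym)

  a-increasing : ∀ j j′ → toℕ p < toℕ j → toℕ j′ ≡ suc (toℕ j) → toℕ j′ ≤ toℕ t → val v j < val v j′
  a-increasing j j′ p<j j′≡1+j j′≤t = ascent-after-inversion v fc-v p<j j<j′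
    (val-≤∧≢⇒< v (p-max j (<⇒≤ (<-≤-trans j<j′ j′≤t))) (<⇒≢ᶠ p<j ∘ sym))
    where
    j<j′ : toℕ j < toℕ j′
    j<j′ = ≤-reflexive (sym j′≡1+j)

  e-increasing : ∀ j j′ → toℕ t < toℕ j → toℕ j′ ≡ suc (toℕ j) → toℕ j′ < toℕ q → val v j < val v j′
  e-increasing j j′ t<j j′≡1+j j′<q = ascent-before-inversion v fc-v j<j′ j′<q
    (val-≤∧≢⇒< v (q-min j′ (<-trans t<j j<j′)) (<⇒≢ᶠ j′<q ∘ sym))
    where
    j<j′ : toℕ j < toℕ j′
    j<j′ = ≤-reflexive (sym j′≡1+j)
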